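{- Let $k\ge1$ and $n\ge0$. The number of elements of $C_k\wr S_n$ that bi-avoid $\Gamma_1=\{(1\text{ - }2,0~0),(1\text{ - }2,1~0),(2\text{ - }1,1~0)\}$ equals $k^n$, and the number of elements of $C_k\wr S_n$ that bi-avoid $\Gamma_2=\{(2\text{ - }1,0~0),(1\text{ - }2,1~0),(2\text{ - }1,1~0)\}$ equals $k^n$.
   Context: For integers $k\ge1$, $n\ge0$, $C_k\wr S_n$ denotes the set of pairs $(\sigma,w)$ where $\sigma=\sigma_1\cdots\sigma_n$ is a permutation of $\{1,\dots,n\}$ in one-line notation and $w=w_1\cdots w_n\in\{0,1,\dots,k-1\}^n$. For a pattern $(\tau,u)$ with $\tau\in S_2$ and $u\in\{00,01,10\}$ (e.g. $(2\text{ - }1,1~0)$ means $\tau=21$, $u=10$), $(\tau,u)$ bi-occurs in $(\sigma,w)$ if there are $1\le i_1<i_2\le n$ (not necessarily adjacent) such that the relative order of $\sigma_{i_1},\sigma_{i_2}$ is that of $\tau$ and the relative order of $w_{i_1},w_{i_2}$ is that of $u$ (for $u=00$: $w_{i_1}=w_{i_2}$; $u=01$: $w_{i_1}<w_{i_2}$; $u=10$: $w_{i_1}>w_{i_2}$). $(\sigma,w)$ bi-avoids a set of patterns if no member bi-occurs in it. -}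

module Defs where

open import Data.Nat using (ℕ; zero; suc; _<_)
open import Data.Fin using (Fin; toℕ; _<?_) renaming (_<_ to _<ᶠ_)
open import Data.Fin.Properties using (all?; any?; _≟_)
open import Data.Vec using (Vec; []; _∷_; lookup)
open import Data.List using (List; []; _∷_; concatMap; map; filter; length; cartesianProduct; allFin)
open import Data.Product using (_×_; _,_; Σ; ∃; proj₁; proj₂)
open import Data.Sum using (_⊎_)
open import Relation.Binary.PropositionalEquality using (_≡_)
open import Relation.Nullary using (¬_; Dec)
open import Relation.Nullary.Decidable using (¬?; _×-dec_; _⊎-dec_; _→-dec_)
open import Relation.Unary using (Decidable)
open import Data.List.Relation.Unary.All using (All) renaming (all? to allL?)

allVecs : (m n : ℕ) → List (Vec (Fin m) n)
allVecs m zero = [] ∷ []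
allVecs m (suc n) = concatMap (λ x → map (x ∷_) (allVecs m n)) (allFin m)

-- One-line notation σ = σ₁⋯σₙ with values in Fin n (i.e. {1..n} shifted to {0..n-1}).
-- σ is a permutation iff its entries are pairwise distinct.
IsPerm : ∀ {n} → Vec (Fin n) n → Set
IsPerm {n} σ = (i j : Fin n) → lookup σ i ≡ lookup σ j → i ≡ j

isPerm? : ∀ {n} → Decidable (IsPerm {n})
isPerm? {n} σ = all? λ i → all? λ j → (lookup σ i ≟ lookup σ j) →-dec (i ≟ j)

data Tau : Set where
  t12 t21 : Tau

data U : Set where
  u00 u01 u10 : U

TauOrder : ∀ {m} → Tau → Fin m → Fin m → Set
TauOrder t12 a b = a <ᶠ b
TauOrder t21 a b = b <ᶠ a

tauOrder? : ∀ {m} (t : Tau) (a b : Fin m) → Dec (TauOrder t a b)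
tauOrder? t12 a b = a <? b
tauOrder? t21 a b = b <? a

UOrder : ∀ {m} → U → Fin m → Fin m → Set
UOrder u00 a b = a ≡ b
UOrder u01 a b = a <ᶠ b
UOrder u10 a b = b <ᶠ a

uOrder? : ∀ {m} (u : U) (a b : Fin m) → Dec (UOrder u a b)
uOrder? u00 a b = a ≟ b
uOrder? u01 a b = a <? b
uOrder? u10 a b = b <? a

Pattern : Set
Pattern = Tau × U

-- Elements of C_k ≀ S_n, represented as (σ , w); σ is required to satisfy IsPerm.
Elem : ℕ → ℕ → Set
Elem k n = Vec (Fin n) n × Vec (Fin k) n

BiOccurs : ∀ {k n} → Pattern → Elem k n → Set
BiOccurs {k} {n} (τ , u) (σ , w) =
  Σ (Fin n) λ i₁ → Σ (Fin n) λ i₂ →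
    (i₁ <ᶠ i₂) × TauOrder τ (lookup σ i₁) (lookup σ i₂) × UOrder u (lookup w i₁) (lookup w i₂)

biOccurs? : ∀ {k n} (p : Pattern) → Decidable (BiOccurs {k} {n} p)
biOccurs? (τ , u) (σ , w) = any? λ i₁ → any? λ i₂ →
  (i₁ <? i₂) ×-dec (tauOrder? τ _ _ ×-dec uOrder? u _ _)

BiAvoids : ∀ {k n} → List Pattern → Elem k n → Set
BiAvoids ps e = All (λ p → ¬ BiOccurs p e) ps

biAvoids? : ∀ {k n} (ps : List Pattern) → Decidable (BiAvoids {k} {n} ps)
biAvoids? ps e = allL? (λ p → ¬? (biOccurs? p e)) ps

wreath : (k n : ℕ) → List (Elem k n)
wreath k n = cartesianProduct (filter isPerm? (allVecs n n)) (allVecs k n)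

countBiAvoiders : (k n : ℕ) → List Pattern → ℕ
countBiAvoiders k n ps = length (filter (biAvoids? ps) (wreath k n))

Γ₁ : List Pattern
Γ₁ = (t12 , u00) ∷ (t12 , u10) ∷ (t21 , u10) ∷ []

Γ₂ : List Pattern
Γ₂ = (t21 , u00) ∷ (t12 , u10) ∷ (t21 , u10) ∷ []

-- For a permutation σ, bi-avoiding Γ₁ or Γ₂ says exactly that the pairs (w i , σ i) strictly
-- increase with i in the lexicographic order comparing colours first and then values, by <
-- for Γ₂ and by > for Γ₁: an occurrence of (τ , 1 0) is a colour descent, and an occurrence
-- of the remaining pattern (τ , 0 0) is an inversion inside a colour class.  An avoider is
-- therefore the increasing enumeration of the graph {(v a , a)} of its colouring v = w ∘ σ⁻¹
-- of the values, and sorting graphs is a bijection from the k ^ n colourings onto the avoiders.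

module Submission where

open import Level using (_⊔_; 0ℓ)
open import Data.Nat using (ℕ; zero; suc; _+_; _*_; _^_; _≥_; s≤s; z≤n)
open import Data.Nat.Properties using (n<1+n)
open import Data.Fin using (Fin; punchOut) renaming (zero to fzero; suc to fsuc; _<_ to _<ᶠ_)
open import Data.Fin.Properties
  using (<-cmp; <-trans; <-irrefl; <-asym; <⇒≢; any?; _≟_; pigeonhole; punchOut-injective)
open import Data.Product using (_×_; _,_; proj₁; proj₂; ∃; swap)
open import Data.Product.Relation.Binary.Lex.Strict using (×-Lex; ×-transitive; ×-compare)
open import Data.Product.Relation.Binary.Pointwise.NonDependent using (≡×≡⇒≡; ≡⇒≡×≡)
open import Data.Sum as Sum using (_⊎_; inj₁; inj₂)
open import Data.List
  using (List; []; _∷_; _++_; map; filter; length; concatMap; cartesianProductWith; allFin)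
open import Data.List.Properties using (length-++; length-map; length-tabulate)
open import Data.List.Membership.Propositional using (_∈_)
open import Data.List.Membership.Propositional.Properties
  using ( ∈-map⁺; ∈-map⁻; ∈-filter⁺; ∈-filter⁻; ∈-cartesianProduct⁺; ∈-cartesianProduct⁻
        ; ∈-cartesianProductWith⁺; ∈-allFin)
open import Data.List.Membership.Propositional.Properties.WithK using (unique∧set⇒bag)
open import Data.List.Relation.Binary.BagAndSetEquality using (_∼[_]_; set; ∼bag⇒↭)
open import Data.List.Relation.Binary.Permutation.Propositional.Properties using (↭-length)
open import Data.List.Relation.Unary.Any using (here)
open import Data.List.Relation.Unary.All using ([]; _∷_)
open import Data.List.Relation.Unary.AllPairs using ([]; _∷_)
open import Data.List.Relation.Unary.Unique.Propositional using () renaming (Unique to UniqueList)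
open import Data.List.Relation.Unary.Unique.Propositional.Properties
  using (cartesianProduct⁺; cartesianProductWith⁺; allFin⁺; filter⁺)
  renaming (map⁺ to mapList⁺)
open import Data.Vec using (Vec; []; _∷_; lookup; tabulate; zip; unzip)
open import Data.Vec.Properties
  using ( ∷-injective; lookup-zip; lookup-unzip; unzip∘zip; zip∘unzip
        ; tabulate∘lookup; tabulate-cong; lookup∘tabulate)
open import Data.Vec.Membership.Propositional using () renaming (_∈_ to _∈ᵥ_; _∉_ to _∉ᵥ_)
open import Data.Vec.Membership.Propositional.Properties using (∈-lookup; ∈-tabulate⁺)
open import Data.Vec.Relation.Unary.All as All using (All; []; _∷_)
open import Data.Vec.Relation.Unary.All.Properties using (lookup⁺; lookup⁻)
open import Data.Vec.Relation.Unary.Any as Any using (here; there)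
open import Data.Vec.Relation.Unary.Any.Properties using (lookup-index; tabulate⁻)
open import Data.Vec.Relation.Unary.AllPairs as AllPairs using (AllPairs; []; _∷_)
open import Data.Vec.Relation.Unary.Unique.Propositional using (Unique)
open import Data.Vec.Relation.Unary.Unique.Propositional.Properties
  using (lookup-injective) renaming (tabulate⁺ to Unique-tabulate⁺)
open import Function.Bundles using (mk⇔)
open import Function.Definitions using (Injective)
open import Relation.Binary using (Rel; Transitive; Trichotomous; tri<; tri≈; tri>)
open import Relation.Binary.Consequences using (tri⇒irr; tri⇒asym)
import Relation.Binary.Construct.Flip.EqAndOrd as Flip
open import Relation.Binary.PropositionalEquality
  using ( _≡_; _≢_; refl; sym; trans; cong; cong₂; subst; subst₂
        ; isEquivalence; resp₂; module ≡-Reasoning)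
open import Relation.Nullary using (¬_; yes; no; contradiction)

open import Defs

module InsertionSort {a ℓ} {A : Set a} {_<_ : Rel A ℓ}
  (<-trans : Transitive _<_) (compare : Trichotomous _≡_ _<_) where

  private
    variable
      m : ℕ
      x y z : A
      xs ys : Vec A m

  Increasing : Vec A m → Set (a ⊔ ℓ)
  Increasing = AllPairs _<_

  increasing⇒unique : Increasing xs → Unique xs
  increasing⇒unique = AllPairs.map (λ x<y x≡y → tri⇒irr compare x≡y x<y)

  lookup-increasing : Increasing xs → ∀ {i j} → i <ᶠ j → lookup xs i < lookup xs j
  lookup-increasing (x<xs ∷ _) {fzero} {fsuc j} _ = lookup⁺ x<xs j
  lookup-increasing (_ ∷ inc) {fsuc i} {fsuc j} (s≤s i<j) = lookup-increasing inc i<j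

  increasing⁺ : (∀ {i j} → i <ᶠ j → lookup xs i < lookup xs j) → Increasing xs
  increasing⁺ {xs = []} _ = []
  increasing⁺ {xs = x ∷ xs} mono =
    lookup⁻ (λ j → mono (s≤s z≤n)) ∷ increasing⁺ (λ i<j → mono (s≤s i<j))

  insert : A → Vec A m → Vec A (suc m)
  insert x [] = x ∷ []
  insert x (y ∷ ys) with compare x y
  ... | tri< _ _ _ = x ∷ y ∷ ys
  ... | tri≈ _ _ _ = y ∷ insert x ys
  ... | tri> _ _ _ = y ∷ insert x ys

  sort : Vec A m → Vec A m
  sort [] = []
  sort (x ∷ xs) = insert x (sort xs)

  All-insert : ∀ {p} {P : A → Set p} → P x → All P ys → All P (insert x ys)
  All-insert {ys = []} px [] = px ∷ []
  All-insert {x = x} {ys = y ∷ ys} px (py ∷ pys) with compare x y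
  ... | tri< _ _ _ = px ∷ py ∷ pys
  ... | tri≈ _ _ _ = py ∷ All-insert px pys
  ... | tri> _ _ _ = py ∷ All-insert px pys

  ∈-insert⁺ˡ : x ∈ᵥ insert x ys
  ∈-insert⁺ˡ {ys = []} = here refl
  ∈-insert⁺ˡ {x = x} {ys = y ∷ ys} with compare x y
  ... | tri< _ _ _ = here refl
  ... | tri≈ _ _ _ = there (∈-insert⁺ˡ {ys = ys})
  ... | tri> _ _ _ = there (∈-insert⁺ˡ {ys = ys})

  ∈-insert⁺ʳ : z ∈ᵥ ys → z ∈ᵥ insert x ys
  ∈-insert⁺ʳ {ys = y ∷ ys} {x = x} z∈ys with compare x y
  ... | tri< _ _ _ = there z∈ys
  ∈-insert⁺ʳ (here z≡y)   | tri≈ _ _ _ = here z≡y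
  ∈-insert⁺ʳ (there z∈ys) | tri≈ _ _ _ = there (∈-insert⁺ʳ z∈ys)
  ∈-insert⁺ʳ (here z≡y)   | tri> _ _ _ = here z≡y
  ∈-insert⁺ʳ (there z∈ys) | tri> _ _ _ = there (∈-insert⁺ʳ z∈ys)

  ∈-insert⁻ : z ∈ᵥ insert x ys → z ≡ x ⊎ z ∈ᵥ ys
  ∈-insert⁻ {ys = []} (here z≡x) = inj₁ z≡x
  ∈-insert⁻ {x = x} {ys = y ∷ ys} z∈ with compare x y
  ∈-insert⁻ (here z≡x)   | tri< _ _ _ = inj₁ z≡x
  ∈-insert⁻ (there z∈ys) | tri< _ _ _ = inj₂ z∈ys
  ∈-insert⁻ (here z≡y)   | tri≈ _ _ _ = inj₂ (here z≡y)
  ∈-insert⁻ (there z∈)   | tri≈ _ _ _ = Sum.map₂ there (∈-insert⁻ z∈)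
  ∈-insert⁻ (here z≡y)   | tri> _ _ _ = inj₂ (here z≡y)
  ∈-insert⁻ (there z∈)   | tri> _ _ _ = Sum.map₂ there (∈-insert⁻ z∈)

  insert-increasing : x ∉ᵥ ys → Increasing ys → Increasing (insert x ys)
  insert-increasing {ys = []} x∉ [] = [] ∷ []
  insert-increasing {x = x} {ys = y ∷ ys} x∉ (y<ys ∷ inc) with compare x y
  ... | tri< x<y _ _ = (x<y ∷ All.map (<-trans x<y) y<ys) ∷ y<ys ∷ inc
  ... | tri≈ _ x≡y _ = contradiction (here x≡y) x∉
  ... | tri> _ _ y<x =
    All-insert y<x y<ys ∷ insert-increasing (λ x∈ys → x∉ (there x∈ys)) inc

  ∈-sort⁺ : z ∈ᵥ xs → z ∈ᵥ sort xs
  ∈-sort⁺ {xs = _ ∷ xs} (here refl) = ∈-insert⁺ˡ {ys = sort xs}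
  ∈-sort⁺ (there z∈xs) = ∈-insert⁺ʳ (∈-sort⁺ z∈xs)

  ∈-sort⁻ : z ∈ᵥ sort xs → z ∈ᵥ xs
  ∈-sort⁻ {xs = x ∷ xs} z∈ with ∈-insert⁻ z∈
  ... | inj₁ z≡x = here z≡x
  ... | inj₂ z∈sort = there (∈-sort⁻ z∈sort)

  sort-increasing : Unique xs → Increasing (sort xs)
  sort-increasing [] = []
  sort-increasing (x≢xs ∷ u) =
    insert-increasing (λ x∈ → All.lookup x≢xs (∈-sort⁻ x∈) refl) (sort-increasing u)

  increasing∧sameElements⇒≡ : Increasing xs → Increasing ys →
    (∀ {z} → z ∈ᵥ xs → z ∈ᵥ ys) → (∀ {z} → z ∈ᵥ ys → z ∈ᵥ xs) → xs ≡ ys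
  increasing∧sameElements⇒≡ [] [] _ _ = refl
  increasing∧sameElements⇒≡ {xs = x ∷ xs} {ys = y ∷ ys} (x<xs ∷ incx) (y<ys ∷ incy) xs⊆ys ys⊆xs =
    cong₂ _∷_ x≡y (increasing∧sameElements⇒≡ incx incy tail⊆ tail⊇)
    where
    x≡y : x ≡ y
    x≡y with xs⊆ys (here refl) | ys⊆xs (here refl)
    ... | here x≡y | _ = x≡y
    ... | there _ | here y≡x = sym y≡x
    ... | there x∈ys | there y∈xs =
      contradiction (All.lookup y<ys x∈ys) (tri⇒asym compare (All.lookup x<xs y∈xs))
    tail⊆ : ∀ {z} → z ∈ᵥ xs → z ∈ᵥ ys
    tail⊆ z∈xs with xs⊆ys (there z∈xs)
    ... | there z∈ys = z∈ys
    ... | here z≡y =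
      contradiction (All.lookup x<xs z∈xs) (tri⇒irr compare (trans x≡y (sym z≡y)))
    tail⊇ : ∀ {z} → z ∈ᵥ ys → z ∈ᵥ xs
    tail⊇ z∈ys with ys⊆xs (there z∈ys)
    ... | there z∈xs = z∈xs
    ... | here z≡x =
      contradiction (All.lookup y<ys z∈ys) (tri⇒irr compare (trans (sym x≡y) (sym z≡x)))

injective⇒surjective : ∀ {n} {f : Fin n → Fin n} → Injective _≡_ _≡_ f → ∀ j → ∃ λ i → f i ≡ j
injective⇒surjective {suc n} {f} f-inj j with any? (λ i → f i ≟ j)
... | yes hit = hit
... | no miss =
  let i , i′ , i<i′ , collision = pigeonhole (n<1+n n) (λ i → punchOut (j≢f i))
  in contradiction (f-inj (punchOut-injective (j≢f i) (j≢f i′) collision)) (<⇒≢ i<i′)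
  where
  j≢f : ∀ i → j ≢ f i
  j≢f i j≡fi = miss (i , sym j≡fi)

unique∧set⇒length≡ : ∀ {a} {A : Set a} {xs ys : List A} →
  UniqueList xs → UniqueList ys → xs ∼[ set ] ys → length xs ≡ length ys
unique∧set⇒length≡ xs! ys! xs≈ys = ↭-length (∼bag⇒↭ (unique∧set⇒bag xs! ys! xs≈ys))

length-cartesianProductWith : ∀ {a b c} {A : Set a} {B : Set b} {C : Set c}
  (f : A → B → C) (xs : List A) (ys : List B) →
  length (cartesianProductWith f xs ys) ≡ length xs * length ys
length-cartesianProductWith f [] ys = refl
length-cartesianProductWith f (x ∷ xs) ys = begin
  length (map (f x) ys ++ cartesianProductWith f xs ys)
    ≡⟨ length-++ (map (f x) ys) ⟩
  length (map (f x) ys) + length (cartesianProductWith f xs ys)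
    ≡⟨ cong₂ _+_ (length-map (f x) ys) (length-cartesianProductWith f xs ys) ⟩
  length ys + length xs * length ys
    ∎
  where open ≡-Reasoning

allVecs-suc : ∀ m n → allVecs m (suc n) ≡ cartesianProductWith _∷_ (allFin m) (allVecs m n)
allVecs-suc m n = concatMap-map (allFin m)
  where
  concatMap-map : ∀ xs → concatMap (λ x → map (x ∷_) (allVecs m n)) xs
                        ≡ cartesianProductWith _∷_ xs (allVecs m n)
  concatMap-map [] = refl
  concatMap-map (x ∷ xs) = cong (map (x ∷_) (allVecs m n) ++_) (concatMap-map xs)

allVecs-unique : ∀ m n → UniqueList (allVecs m n)
allVecs-unique m zero = [] ∷ []
allVecs-unique m (suc n) rewrite allVecs-suc m n =
  cartesianProductWith⁺ _∷_ ∷-injective (allFin⁺ m) (allVecs-unique m n)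

∈-allVecs : ∀ {m n} (v : Vec (Fin m) n) → v ∈ allVecs m n
∈-allVecs [] = here refl
∈-allVecs {m} {suc n} (x ∷ v) rewrite allVecs-suc m n =
  ∈-cartesianProductWith⁺ _∷_ (∈-allFin x) (∈-allVecs v)

length-allVecs : ∀ m n → length (allVecs m n) ≡ m ^ n
length-allVecs m zero = refl
length-allVecs m (suc n) = begin
  length (allVecs m (suc n))
    ≡⟨ cong length (allVecs-suc m n) ⟩
  length (cartesianProductWith _∷_ (allFin m) (allVecs m n))
    ≡⟨ length-cartesianProductWith _∷_ (allFin m) (allVecs m n) ⟩
  length (allFin m) * length (allVecs m n)
    ≡⟨ cong₂ _*_ (length-tabulate {n = m} (λ i → i)) (length-allVecs m n) ⟩
  m * m ^ n
    ∎
  where open ≡-Reasoning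

wreath-unique : ∀ k n → UniqueList (wreath k n)
wreath-unique k n = cartesianProduct⁺ (filter⁺ isPerm? (allVecs-unique n n)) (allVecs-unique k n)

∈-wreath⁺ : ∀ {k n} {σ : Vec (Fin n) n} (w : Vec (Fin k) n) → IsPerm σ → (σ , w) ∈ wreath k n
∈-wreath⁺ {σ = σ} w σ-perm =
  ∈-cartesianProduct⁺ (∈-filter⁺ isPerm? (∈-allVecs σ) σ-perm) (∈-allVecs w)

∈-wreath⁻ : ∀ {k n} {σ : Vec (Fin n) n} {w : Vec (Fin k) n} → (σ , w) ∈ wreath k n → IsPerm σ
∈-wreath⁻ {k} {n} σw∈ = proj₂ (∈-filter⁻ isPerm? {xs = allVecs n n}
  (proj₁ (∈-cartesianProduct⁻ (filter isPerm? (allVecs n n)) (allVecs k n) σw∈)))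

module _ {a b} {A : Set a} {B : Set b} {n : ℕ} {xs : Vec A n} {ys : Vec B n} where

  ∈-zip⁺ : ∀ i → (lookup xs i , lookup ys i) ∈ᵥ zip xs ys
  ∈-zip⁺ i = subst (_∈ᵥ zip xs ys) (lookup-zip i xs ys) (∈-lookup i (zip xs ys))

  ∈-zip⁻ : ∀ {x y} → (x , y) ∈ᵥ zip xs ys → ∃ λ i → lookup xs i ≡ x × lookup ys i ≡ y
  ∈-zip⁻ xy∈ = i , cong proj₁ at-i , cong proj₂ at-i
    where
    i : Fin n
    i = Any.index xy∈
    at-i : (lookup xs i , lookup ys i) ≡ _
    at-i = trans (sym (lookup-zip i xs ys)) (sym (lookup-index xy∈))

flipTau : Tau → Tau
flipTau t12 = t21
flipTau t21 = t12

flipTau-order : ∀ {m} t {a b : Fin m} → TauOrder t b a → TauOrder (flipTau t) a b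
flipTau-order t12 b<a = b<a
flipTau-order t21 a<b = a<b

flipTau-order⁻ : ∀ {m} t {a b : Fin m} → TauOrder (flipTau t) a b → TauOrder t b a
flipTau-order⁻ t12 b<a = b<a
flipTau-order⁻ t21 a<b = a<b

tauOrder-trans : ∀ {m} t → Transitive (TauOrder {m} t)
tauOrder-trans t12 = <-trans
tauOrder-trans t21 = Flip.trans _<ᶠ_ <-trans

tauOrder-compare : ∀ {m} t → Trichotomous _≡_ (TauOrder {m} t)
tauOrder-compare t12 = <-cmp
tauOrder-compare t21 = Flip.compare _<ᶠ_ <-cmp

Γ : Tau → List Pattern
Γ t = (flipTau t , u00) ∷ (t12 , u10) ∷ (t21 , u10) ∷ []

module Avoiders (t : Tau) (k n : ℕ) where

  _≺_ : Rel (Fin k × Fin n) 0ℓ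
  _≺_ = ×-Lex _≡_ _<ᶠ_ (TauOrder t)

  ≺-trans : Transitive _≺_
  ≺-trans = ×-transitive {_<₂_ = TauOrder t} isEquivalence (resp₂ _<ᶠ_) <-trans (tauOrder-trans t)

  ≺-compare : Trichotomous _≡_ _≺_
  ≺-compare p q with ×-compare sym <-cmp (tauOrder-compare t) p q
  ... | tri< p≺q p≉q p≻q = tri< p≺q (λ p≡q → p≉q (≡⇒≡×≡ p≡q)) p≻q
  ... | tri≈ p⊀q p≈q p⊁q = tri≈ p⊀q (≡×≡⇒≡ p≈q) p⊁q
  ... | tri> p⊀q p≉q p≻q = tri> p⊀q (λ p≡q → p≉q (≡⇒≡×≡ p≡q)) p≻q

  open InsertionSort ≺-trans ≺-compare

  module _ {σ : Vec (Fin n) n} {w : Vec (Fin k) n} (σ-perm : IsPerm σ)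
           {i j : Fin n} (i<j : i <ᶠ j) where

    equal-colours-ordered : ¬ BiOccurs (flipTau t , u00) (σ , w) →
      lookup w i ≡ lookup w j → TauOrder t (lookup σ i) (lookup σ j)
    equal-colours-ordered no-flip wi≡wj with tauOrder-compare t (lookup σ i) (lookup σ j)
    ... | tri< σi<σj _ _ = σi<σj
    ... | tri≈ _ σi≡σj _ = contradiction (σ-perm i j σi≡σj) (<⇒≢ i<j)
    ... | tri> _ _ σj<σi = contradiction (i , j , i<j , flipTau-order t σj<σi , wi≡wj) no-flip

    no-colour-descent : ¬ BiOccurs (t12 , u10) (σ , w) → ¬ BiOccurs (t21 , u10) (σ , w) →
      ¬ lookup w j <ᶠ lookup w i
    no-colour-descent no-12 no-21 wj<wi with <-cmp (lookup σ i) (lookup σ j)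
    ... | tri< σi<σj _ _ = no-12 (i , j , i<j , σi<σj , wj<wi)
    ... | tri≈ _ σi≡σj _ = <⇒≢ i<j (σ-perm i j σi≡σj)
    ... | tri> _ _ σj<σi = no-21 (i , j , i<j , σj<σi , wj<wi)

  avoids⇒increasing : ∀ {σ w} → IsPerm σ → BiAvoids (Γ t) (σ , w) → Increasing (zip w σ)
  avoids⇒increasing {σ} {w} σ-perm (no-flip ∷ no-12 ∷ no-21 ∷ []) = increasing⁺ λ {i} {j} i<j →
    subst₂ _≺_ (sym (lookup-zip i w σ)) (sym (lookup-zip j w σ)) (ordered i<j)
    where
    ordered : ∀ {i j} → i <ᶠ j → (lookup w i , lookup σ i) ≺ (lookup w j , lookup σ j)
    ordered {i} {j} i<j with <-cmp (lookup w i) (lookup w j)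
    ... | tri< wi<wj _ _ = inj₁ wi<wj
    ... | tri≈ _ wi≡wj _ = inj₂ (wi≡wj , equal-colours-ordered {σ} {w} σ-perm i<j no-flip wi≡wj)
    ... | tri> _ _ wj<wi = contradiction wj<wi (no-colour-descent {σ} {w} σ-perm i<j no-12 no-21)

  increasing⇒avoids : ∀ {σ w} → Increasing (zip w σ) → BiAvoids (Γ t) (σ , w)
  increasing⇒avoids {σ} {w} inc = no-flip ∷ no-descent t12 ∷ no-descent t21 ∷ []
    where
    ordered : ∀ {i j} → i <ᶠ j → (lookup w i , lookup σ i) ≺ (lookup w j , lookup σ j)
    ordered {i} {j} i<j = subst₂ _≺_ (lookup-zip i w σ) (lookup-zip j w σ) (lookup-increasing inc i<j)
    no-flip : ¬ BiOccurs (flipTau t , u00) (σ , w)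
    no-flip (i , j , i<j , flipped , wi≡wj) with ordered i<j
    ... | inj₁ wi<wj = <-irrefl wi≡wj wi<wj
    ... | inj₂ (_ , σi<σj) = tri⇒asym (tauOrder-compare t) σi<σj (flipTau-order⁻ t flipped)
    no-descent : ∀ τ → ¬ BiOccurs (τ , u10) (σ , w)
    no-descent τ (i , j , i<j , _ , wj<wi) with ordered i<j
    ... | inj₁ wi<wj = <-asym wi<wj wj<wi
    ... | inj₂ (wi≡wj , _) = <-irrefl (sym wi≡wj) wj<wi

  graph : Vec (Fin k) n → Vec (Fin k × Fin n) n
  graph v = tabulate (λ a → lookup v a , a)

  ∈-graph⁺ : ∀ v a → (lookup v a , a) ∈ᵥ graph v
  ∈-graph⁺ v a = ∈-tabulate⁺ _ a

  ∈-graph⁻ : ∀ v {c a} → (c , a) ∈ᵥ graph v → lookup v a ≡ c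
  ∈-graph⁻ v ca∈ with tabulate⁻ ca∈
  ... | _ , refl = refl

  graph-unique : ∀ v → Unique (graph v)
  graph-unique v = Unique-tabulate⁺ (cong proj₂)

  graph-functional : ∀ v {p q} → p ∈ᵥ graph v → q ∈ᵥ graph v → proj₂ p ≡ proj₂ q → p ≡ q
  graph-functional v {p = c , a} {q = c′ , .a} p∈ q∈ refl =
    cong (_, a) (trans (sym (∈-graph⁻ v p∈)) (∈-graph⁻ v q∈))

  pairs : Elem k n → Vec (Fin k × Fin n) n
  pairs (σ , w) = zip w σ

  unpairs : Vec (Fin k × Fin n) n → Elem k n
  unpairs ps = swap (unzip ps)

  pairs∘unpairs : ∀ ps → pairs (unpairs ps) ≡ ps
  pairs∘unpairs = zip∘unzip

  unpairs∘pairs : ∀ e → unpairs (pairs e) ≡ e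
  unpairs∘pairs (σ , w) = cong swap (unzip∘zip w σ)

  fromWord : Vec (Fin k) n → Elem k n
  fromWord v = unpairs (sort (graph v))

  fromWord-perm : ∀ v → IsPerm (proj₁ (fromWord v))
  fromWord-perm v i j σi≡σj =
    lookup-injective (increasing⇒unique (sort-increasing (graph-unique v))) i j
      (graph-functional v (∈-sort⁻ (∈-lookup i ps)) (∈-sort⁻ (∈-lookup j ps))
        (trans (value-at i) (trans σi≡σj (sym (value-at j)))))
    where
    ps : Vec (Fin k × Fin n) n
    ps = sort (graph v)
    value-at : ∀ i → proj₂ (lookup ps i) ≡ lookup (proj₁ (fromWord v)) i
    value-at i = sym (cong proj₂ (lookup-unzip i ps))

  fromWord-avoids : ∀ v → BiAvoids (Γ t) (fromWord v)
  fromWord-avoids v = increasing⇒avoids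
    (subst Increasing (sym (pairs∘unpairs (sort (graph v)))) (sort-increasing (graph-unique v)))

  fromWord-injective : ∀ {v v′} → fromWord v ≡ fromWord v′ → v ≡ v′
  fromWord-injective {v} {v′} eq = begin
    v                    ≡⟨ tabulate∘lookup v ⟨
    tabulate (lookup v)  ≡⟨ tabulate-cong same-colour ⟩
    tabulate (lookup v′) ≡⟨ tabulate∘lookup v′ ⟩
    v′                   ∎
    where
    open ≡-Reasoning
    same-sort : sort (graph v) ≡ sort (graph v′)
    same-sort = trans (sym (pairs∘unpairs _)) (trans (cong pairs eq) (pairs∘unpairs _))
    same-colour : ∀ a → lookup v a ≡ lookup v′ a
    same-colour a =
      sym (∈-graph⁻ v′ (∈-sort⁻ (subst (_ ∈ᵥ_) same-sort (∈-sort⁺ (∈-graph⁺ v a)))))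

  fromWord-surjective : ∀ {σ w} → IsPerm σ → BiAvoids (Γ t) (σ , w) →
    ∃ λ v → fromWord v ≡ (σ , w)
  fromWord-surjective {σ} {w} σ-perm avoids = v , (begin
    unpairs (sort (graph v)) ≡⟨ cong unpairs (increasing∧sameElements⇒≡ (sort-increasing (graph-unique v))
                                  (avoids⇒increasing σ-perm avoids) sorted⊆pairs pairs⊆sorted) ⟩
    unpairs (zip w σ)        ≡⟨ unpairs∘pairs (σ , w) ⟩
    (σ , w)                  ∎)
    where
    open ≡-Reasoning
    σ⁻¹ : Fin n → Fin n
    σ⁻¹ a = proj₁ (injective⇒surjective (σ-perm _ _) a)
    σσ⁻¹ : ∀ a → lookup σ (σ⁻¹ a) ≡ a
    σσ⁻¹ a = proj₂ (injective⇒surjective (σ-perm _ _) a)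
    v : Vec (Fin k) n
    v = tabulate (λ a → lookup w (σ⁻¹ a))
    v∘σ : ∀ i → lookup v (lookup σ i) ≡ lookup w i
    v∘σ i = trans (lookup∘tabulate _ (lookup σ i))
                  (cong (lookup w) (σ-perm _ _ (σσ⁻¹ (lookup σ i))))
    sorted⊆pairs : ∀ {p} → p ∈ᵥ sort (graph v) → p ∈ᵥ zip w σ
    sorted⊆pairs {c , a} p∈ =
      subst (_∈ᵥ zip w σ) (cong₂ _,_ colour (σσ⁻¹ a)) (∈-zip⁺ (σ⁻¹ a))
      where
      colour : lookup w (σ⁻¹ a) ≡ c
      colour = trans (sym (lookup∘tabulate _ a)) (∈-graph⁻ v (∈-sort⁻ p∈))
    pairs⊆sorted : ∀ {p} → p ∈ᵥ zip w σ → p ∈ᵥ sort (graph v)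
    pairs⊆sorted p∈ with ∈-zip⁻ p∈
    ... | i , refl , refl =
      ∈-sort⁺ (subst (_∈ᵥ graph v) (cong (_, lookup σ i) (v∘σ i)) (∈-graph⁺ v (lookup σ i)))

  avoiders : List (Elem k n)
  avoiders = filter (biAvoids? (Γ t)) (wreath k n)

  fromWord-image : map fromWord (allVecs k n) ∼[ set ] avoiders
  fromWord-image = mk⇔ image⊆avoiders avoiders⊆image
    where
    image⊆avoiders : ∀ {e} → e ∈ map fromWord (allVecs k n) → e ∈ avoiders
    image⊆avoiders e∈ with ∈-map⁻ fromWord e∈
    ... | v , _ , refl =
      ∈-filter⁺ (biAvoids? (Γ t)) (∈-wreath⁺ _ (fromWord-perm v)) (fromWord-avoids v)
    avoiders⊆image : ∀ {e} → e ∈ avoiders → e ∈ map fromWord (allVecs k n)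
    avoiders⊆image {σ , w} e∈ with ∈-filter⁻ (biAvoids? (Γ t)) e∈
    ... | e∈wreath , avoids with fromWord-surjective (∈-wreath⁻ e∈wreath) avoids
    ... | v , fromWord-v≡e =
      subst (_∈ map fromWord (allVecs k n)) fromWord-v≡e (∈-map⁺ fromWord (∈-allVecs v))

  countBiAvoiders-Γ : countBiAvoiders k n (Γ t) ≡ k ^ n
  countBiAvoiders-Γ = begin
    length avoiders                     ≡⟨ unique∧set⇒length≡ image-unique avoiders-unique fromWord-image ⟨
    length (map fromWord (allVecs k n)) ≡⟨ length-map fromWord (allVecs k n) ⟩
    length (allVecs k n)                ≡⟨ length-allVecs k n ⟩
    k ^ n                               ∎
    where
    open ≡-Reasoning
    image-unique : UniqueList (map fromWord (allVecs k n))
    image-unique = mapList⁺ fromWord-injective (allVecs-unique k n)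
    avoiders-unique : UniqueList avoiders
    avoiders-unique = filter⁺ (biAvoids? (Γ t)) (wreath-unique k n)

corollary1 : (k n : ℕ) → k ≥ 1 →
    (countBiAvoiders k n Γ₁ ≡ k ^ n) × (countBiAvoiders k n Γ₂ ≡ k ^ n)
corollary1 k n _ = countBiAvoiders-Γ t21 k n , countBiAvoiders-Γ t12 k n
  where open Avoiders using (countBiAvoiders-Γ)
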